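{- For all $j\geq1$ and $i\geq0$, $$f_d(\theta,\theta^{q^{i+1}},\theta^{q^j})\,l_i^{ -d(q-1)}=\sum_{k=0}^{d-1}\binom{d}{k}(\theta-\theta^q)^kf_{d-k}(\theta,\theta^q,\theta^{q^j})\,L_i(\mathfrak{c}_k),$$ where $\mathfrak{c}_k=((d-k)(q-1))\cdot(q-1)^{*k}$.
   Context: Let $\mathbb{F}_q$ be a finite field of characteristic $p$, $K=\mathbb{F}_q(\theta)$, $l_0=1$, $l_i=\prod_{j=1}^i(\theta-\theta^{q^j})$. For $s\ge1$, $f_s(x,y,z)=\sum_{j=0}^{s-1}(z-y)^j(x-y)^{s-1-j}$ (mod $p$); fix $d\ge1$. An array is a tuple $(n_1,\dots,n_r)$ of positive integers ($r\ge1$), plus the empty array $1$; $\mathfrak{H}(K)$ is the $K$-vector space with basis the arrays, with concatenation ($\cdot$ or juxtaposition) extended bilinearly. For $\mathfrak{n}=(n_1,\dots,n_r)$ let $\mathfrak{n}_1=(n_1)$, $\mathfrak{n}_-=(n_2,\dots,n_r)$. Define $L_i(n)=l_i^{ -n}$ for $i\ge0$ and $0$ for $i<0$ (depth one), $L_{<i}(1)=1$, $L_{<i}(\mathfrak{n})=\sum_{j=0}^{i-1}L_j(\mathfrak{n})$, $L_i(\mathfrak{n})=L_i(\mathfrak{n}_1)L_{<i}(\mathfrak{n}_-)$ (depth $\ge2$), extended $K$-linearly. The stuffle product $*$ is bilinear with $1*\mathfrak{m}=\mathfrak{m}*1=\mathfrak{m}$ and $\mathfrak{m}*\mathfrak{n}=\mathfrak{m}_1(\mathfrak{m}_-*\mathfrak{n})+\mathfrak{n}_1(\mathfrak{m}*\mathfrak{n}_-)+(m_1+n_1)(\mathfrak{m}_-*\mathfrak{n}_-)$;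 $\mathfrak{m}^{*k}$ is the $k$-th $*$-power with $\mathfrak{m}^{*0}=1$. -}

module Defs where

open import Level using (Level; _⊔_) renaming (suc to lsuc)
open import Data.Nat as ℕ using (ℕ; zero; suc; _∸_)
open import Data.Nat.Primality using (Prime)
open import Data.Nat.Divisibility using (_∣_)
open import Data.Nat.Combinatorics using (_C_)
open import Data.List using (List; []; _∷_; [_]; map; _++_; concatMap; foldr)
open import Data.Product using (_×_; _,_)
open import Relation.Nullary using (¬_)
open import Algebra.Bundles using (CommutativeRing)
import Algebra.Bundles
import Algebra.Definitions.RawSemiring as RS

-- Fields: a commutative ring with 1 ≉ 0 and multiplicative inverses of
-- nonzero elements (the inverse function is total; its value at 0 is
-- irrelevant).  agda-stdlib 2.3 has no Field bundle.

record Field (c ℓ : Level) : Set (lsuc (c ⊔ ℓ)) where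
  field
    commRing : CommutativeRing c ℓ
  open CommutativeRing commRing public
  field
    _⁻¹      : Carrier → Carrier
    1≉0      : ¬ (1# ≈ 0#)
    inverseʳ : ∀ x → ¬ (x ≈ 0#) → x * (x ⁻¹) ≈ 1#

-- An array (n₁,…,n_r); the empty list is the empty array 1.
Array : Set
Array = List ℕ

-- A formal ℕ-linear combination of arrays, written as a list of arrays
-- (each with coefficient 1, repetitions allowed).  This is the part of
-- 𝔥(K) relevant here: stuffle products of arrays have ℕ coefficients.
HSum : Set
HSum = List Array

stuffle : Array → Array → HSum
stuffle [] n = [ n ]
stuffle (a ∷ m) [] = [ a ∷ m ]
stuffle (a ∷ m) (b ∷ n) =
  map (a ∷_) (stuffle m (b ∷ n))
  ++ map (b ∷_) (stuffle (a ∷ m) n)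
  ++ map (ℕ._+_ a b ∷_) (stuffle m n)

_⋆_ : HSum → HSum → HSum
xs ⋆ ys = concatMap (λ x → concatMap (stuffle x) ys) xs

stufflePow : Array → ℕ → HSum
stufflePow m zero    = [ [] ]
stufflePow m (suc k) = [ m ] ⋆ stufflePow m k

_·_ : Array → HSum → HSum
u · xs = map (λ x → u Data.List.++ x) xs

cArr : (q d k : ℕ) → HSum
cArr q d k = [ ℕ._*_ (d ∸ k) (q ∸ 1) ] · stufflePow [ q ∸ 1 ] k

module _ {c ℓ} (K : Field c ℓ) where
  open Field K
  open RS (Algebra.Bundles.Semiring.rawSemiring semiring) using (_^_) renaming (_×_ to _·ℕ_)

  sumTo : ℕ → (ℕ → Carrier) → Carrier
  sumTo zero    g = 0#
  sumTo (suc n) g = sumTo n g + g n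

  prod1To : ℕ → (ℕ → Carrier) → Carrier
  prod1To zero    g = 1#
  prod1To (suc n) g = prod1To n g * g (suc n)

  nat : ℕ → Carrier
  nat n = n ·ℕ 1#

  fpol : ℕ → Carrier → Carrier → Carrier → Carrier
  fpol s x y z = sumTo s (λ j → ((z - y) ^ j) * ((x - y) ^ (s ∸ 1 ∸ j)))

  module _ (q : ℕ) (θ : Carrier) where
    lfac : ℕ → Carrier
    lfac i = prod1To i (λ j → θ - (θ ^ (q ℕ.^ j)))

    -- L_i(𝔫) for a nonempty array 𝔫 = (n₁ ∷ rest) and L_{<i}(𝔫)
    -- for any array (L_{<i}(1) = 1); indices i ≥ 0 only (the L_i with
    -- i < 0 vanish and are never used in these sums).
    Lat  : ℕ → ℕ → Array → Carrier
    Llt  : ℕ → Array → Carrier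
    Lat i n rest = ((lfac i ⁻¹) ^ n) * Llt i rest
    Llt i []         = 1#
    Llt i (n ∷ rest) = sumTo i (λ j → Lat j n rest)

    -- L_i extended linearly to HSum (the empty array never occurs in
    -- the sums used below; we send it to 1 = L_{<i}(1) for totality)
    LH : ℕ → HSum → Carrier
    LH i xs = foldr (λ x acc → Lx x + acc) 0# xs
      where
      Lx : Array → Carrier
      Lx []         = 1#
      Lx (n ∷ rest) = Lat i n rest

  -- θ is transcendental over the prime field 𝔽_p: a polynomial with
  -- integer (ℕ) coefficients cs (constant term first) vanishes at θ
  -- only if all coefficients are divisible by p.
  evalPoly : List ℕ → Carrier → Carrier
  evalPoly []       x = 0#
  evalPoly (a ∷ cs) x = nat a + x * evalPoly cs x

  data AllDiv (p : ℕ) : List ℕ → Set where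
    []  : AllDiv p []
    _∷_ : ∀ {a cs} → p ∣ a → AllDiv p cs → AllDiv p (a ∷ cs)

  TranscendentalOverPrimeField : ℕ → Carrier → Set ℓ
  TranscendentalOverPrimeField p θ =
    ∀ (cs : List ℕ) → evalPoly cs θ ≈ 0# → AllDiv p cs

  powF : Carrier → ℕ → Carrier
  powF = _^_

-- In characteristic p the Frobenius map turns the recursion l_{i+1} = l_i (θ - θ^{q^{i+1}})
-- into the identity (θ^q - θ^{q^{i+1}}) l_i^{-(q-1)} = (θ - θ^q) L_{<i}(q-1), and L_{<i} is a
-- homomorphism for the stuffle product, so L_i(𝔠_k) = l_i^{-(d-k)(q-1)} L_{<i}(q-1)^k.  Multiplying
-- both sides of the theorem by θ^{q^j} - θ and using f_s(x,y,z)(z - x) = (z - y)^s - (x - y)^s,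
-- the left side becomes (Tβ + Uα)^d - (Tβ + Tα)^d with T = θ - θ^q, U = θ^{q^j} - θ^q,
-- α = l_i^{-(q-1)}, β = L_{<i}(q-1), and the right side becomes its binomial expansion.
-- Transcendence of θ makes θ^{q^j} - θ invertible, so the factor can be cancelled.
module Submission where

open import Defs
open import Data.Nat as ℕ using (ℕ; zero; suc; _≤_; _<_; _∸_; _!; z≤n; s≤s)
import Data.Nat.Properties as ℕₚ
open import Data.Nat.Primality using (Prime; prime; euclidsLemma)
open import Data.Nat.Divisibility using (_∣_; divides; ∣1⇒≡1; ∣⇒≤; m∣m*n)
open import Data.Nat.DivMod using (m/n*n≡m)
open import Data.Nat.Combinatorics using (_C_; nCn≡1; k![n∸k]!∣n!)
open import Data.Nat.Combinatorics.Specification using (nCk≡n!/k![n-k]!)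
open import Data.Fin using (toℕ)
open import Data.List using (List; []; _∷_; [_]; map; _++_; concatMap; foldr; replicate)
open import Data.Sum using (inj₁; inj₂)
open import Data.Empty using (⊥-elim)
open import Relation.Nullary using (¬_)
open import Relation.Binary.PropositionalEquality as ≡ using (_≡_)
import Algebra.Solver.Ring.NaturalCoefficients.Default as Solver
import Algebra.Properties.Semiring.Exp as SemiringExp
import Algebra.Properties.CommutativeSemiring.Exp as CommSemiringExp
import Algebra.Properties.Semiring.Mult as SemiringMult
import Algebra.Properties.CommutativeSemiring.Binomial as Binomial
import Algebra.Properties.Semiring.Sum as SemiringSum
import Algebra.Properties.Ring as RingProperties
import Algebra.Properties.AbelianGroup as AbelianGroupProperties
import Relation.Binary.Reasoning.Setoid as SetoidReasoning

prime⇒2≤ : ∀ {p} → Prime p → 2 ≤ p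
prime⇒2≤ {p} (prime {{nt}} _) = ℕ.nonTrivial⇒n>1 p {{nt}}

2≤m^n : ∀ {m n} → 2 ≤ m → 1 ≤ n → 2 ≤ m ℕ.^ n
2≤m^n {m@(suc _)} {suc n} 2≤m _ = ℕₚ.≤-trans 2≤m (ℕₚ.m≤m*n m (m ℕ.^ n) {{ℕₚ.m^n≢0 m n}})

prime∤! : ∀ {p} → Prime p → ∀ m → m < p → ¬ p ∣ m !
prime∤! pp zero    m<p p∣1 = ⊥-elim (ℕₚ.<-irrefl (≡.sym (∣1⇒≡1 p∣1)) (prime⇒2≤ pp))
prime∤! pp (suc m) m<p p∣m! with euclidsLemma (suc m) (m !) pp p∣m!
... | inj₁ p∣m = ℕₚ.<⇒≱ m<p (∣⇒≤ p∣m)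
... | inj₂ p∣m! = prime∤! pp m (ℕₚ.<-trans (ℕₚ.n<1+n m) m<p) p∣m!

prime∣choose : ∀ {p k} → Prime p → 0 < k → k < p → p ∣ p C k
prime∣choose {p} {k} pp 0<k k<p
  with euclidsLemma (p C k) (k ! ℕ.* (p ∸ k) !) pp p∣product
  where
  choose*factorials : (p C k) ℕ.* (k ! ℕ.* (p ∸ k) !) ≡ p !
  choose*factorials = ≡.trans (≡.cong (ℕ._* (k ! ℕ.* (p ∸ k) !)) (nCk≡n!/k![n-k]! (ℕₚ.<⇒≤ k<p)))
                               (m/n*n≡m {{ℕₚ._!*_!≢0 k (p ∸ k)}} (k![n∸k]!∣n! (ℕₚ.<⇒≤ k<p)))
  n∣n! : ∀ {n} → 0 < n → n ∣ n !
  n∣n! {suc n} _ = m∣m*n (n !)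
  p∣product : p ∣ (p C k) ℕ.* (k ! ℕ.* (p ∸ k) !)
  p∣product = ≡.subst (p ∣_) (≡.sym choose*factorials) (n∣n! (ℕₚ.<-trans 0<k k<p))
... | inj₁ p∣choose = p∣choose
... | inj₂ p∣factorials with euclidsLemma (k !) ((p ∸ k) !) pp p∣factorials
...   | inj₁ p∣k! = ⊥-elim (prime∤! pp k k<p p∣k!)
...   | inj₂ p∣[p∸k]! = ⊥-elim (prime∤! pp (p ∸ k) (ℕₚ.∸-monoʳ-< 0<k (ℕₚ.<⇒≤ k<p)) p∣[p∸k]!)

module FieldProperties {c ℓ} (K : Field c ℓ) where
  open Field K
  open Solver commutativeSemiring using (solve; _:=_; _:+_; _:*_)
  open SemiringExp semiring
  open CommSemiringExp commutativeSemiring using (^-distrib-*)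
  open RingProperties ring using (x[y-z]≈xy-xz; -‿distribʳ-*)
  open AbelianGroupProperties +-abelianGroup
    using (⁻¹-∙-comm; ⁻¹-anti-homo‿-; inverseˡ-unique; inverseʳ-unique; x≈y⇒x∙y⁻¹≈ε)
  open SetoidReasoning setoid

  Σ : ℕ → (ℕ → Carrier) → Carrier
  Σ = sumTo K

  sub-telescope : ∀ a b c → (b - c) + (a - b) ≈ a - c
  sub-telescope a b c = begin
    (b - c) + (a - b)
      ≈⟨ solve 4 (λ b -c a -b → (b :+ -c) :+ (a :+ -b) := (b :+ -b) :+ (a :+ -c)) refl b (- c) a (- b) ⟩
    (b - b) + (a - c) ≈⟨ +-congʳ (-‿inverseʳ b) ⟩
    0# + (a - c)      ≈⟨ +-identityˡ _ ⟩
    a - c             ∎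

  sub-+-interchange : ∀ a b c d → (a - b) + (c - d) ≈ (a + c) - (b + d)
  sub-+-interchange a b c d = begin
    (a - b) + (c - d)
      ≈⟨ solve 4 (λ a -b c -d → (a :+ -b) :+ (c :+ -d) := (a :+ c) :+ (-b :+ -d)) refl a (- b) c (- d) ⟩
    (a + c) + (- b + - d) ≈⟨ +-congˡ (⁻¹-∙-comm b d) ⟩
    (a + c) - (b + d)     ∎

  sub-+-cancelʳ : ∀ a b t → (a + t) - (b + t) ≈ a - b
  sub-+-cancelʳ a b t = begin
    (a + t) - (b + t) ≈⟨ sub-+-interchange a b t t ⟨
    (a - b) + (t - t) ≈⟨ +-congˡ (-‿inverseʳ t) ⟩
    (a - b) + 0#      ≈⟨ +-identityʳ _ ⟩
    a - b             ∎

  ^-zero : ∀ x {n} → n ≡ 0 → x ^ n ≈ 1#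
  ^-zero x ≡.refl = refl

  1^n≈1 : ∀ n → 1# ^ n ≈ 1#
  1^n≈1 zero    = refl
  1^n≈1 (suc n) = trans (*-identityˡ _) (1^n≈1 n)

  Σ-cong : ∀ n {g h : ℕ → Carrier} → (∀ k → k < n → g k ≈ h k) → Σ n g ≈ Σ n h
  Σ-cong zero    g≈h = refl
  Σ-cong (suc n) g≈h = +-cong (Σ-cong n (λ k k<n → g≈h k (ℕₚ.m<n⇒m<1+n k<n))) (g≈h n (ℕₚ.n<1+n n))

  Σ-≈0 : ∀ n (g : ℕ → Carrier) → (∀ k → k < n → g k ≈ 0#) → Σ n g ≈ 0#
  Σ-≈0 zero    g g≈0 = refl
  Σ-≈0 (suc n) g g≈0 =
    trans (+-cong (Σ-≈0 n g (λ k k<n → g≈0 k (ℕₚ.m<n⇒m<1+n k<n))) (g≈0 n (ℕₚ.n<1+n n))) (+-identityˡ 0#)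

  Σ-suc : ∀ n (g : ℕ → Carrier) → Σ (suc n) g ≈ g 0 + Σ n (λ k → g (suc k))
  Σ-suc zero    g = trans (+-identityˡ _) (sym (+-identityʳ _))
  Σ-suc (suc n) g = trans (+-congʳ (Σ-suc n g)) (+-assoc _ _ _)

  *-distribˡ-Σ : ∀ n (g : ℕ → Carrier) x → x * Σ n g ≈ Σ n (λ k → x * g k)
  *-distribˡ-Σ zero    g x = zeroʳ x
  *-distribˡ-Σ (suc n) g x = trans (distribˡ x _ _) (+-congʳ (*-distribˡ-Σ n g x))

  *-distribʳ-Σ : ∀ n (g : ℕ → Carrier) x → Σ n g * x ≈ Σ n (λ k → g k * x)
  *-distribʳ-Σ zero    g x = zeroˡ x
  *-distribʳ-Σ (suc n) g x = trans (distribʳ x _ _) (+-congʳ (*-distribʳ-Σ n g x))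

  Σ-distrib-sub : ∀ n (g h : ℕ → Carrier) → Σ n (λ k → g k - h k) ≈ Σ n g - Σ n h
  Σ-distrib-sub zero    g h = sym (-‿inverseʳ 0#)
  Σ-distrib-sub (suc n) g h = trans (+-congʳ (Σ-distrib-sub n g h)) (sub-+-interchange _ _ _ _)

  Σ≈sum : ∀ n (g : ℕ → Carrier) → Σ n g ≈ SemiringSum.sum semiring {n} (λ i → g (toℕ i))
  Σ≈sum zero    g = refl
  Σ≈sum (suc n) g = trans (Σ-suc n g) (+-congˡ (Σ≈sum n (λ k → g (suc k))))

  binomial : ∀ n x y → (x + y) ^ n ≈ Σ (suc n) (λ k → nat K (n C k) * (x ^ k * y ^ (n ∸ k)))
  binomial n x y = trans (Binomial.theorem commutativeSemiring n x y) (sym (trans (Σ≈sum (suc n) _)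
    (SemiringSum.sum-cong-≋ semiring {suc n} (λ i → sym (×≈nat* (n C toℕ i) (x ^ toℕ i * y ^ (n ∸ toℕ i)))))))
    where
    open SemiringMult semiring using (_×_; ×-assoc-*; ×-congʳ)
    ×≈nat* : ∀ n x → n × x ≈ nat K n * x
    ×≈nat* m w = sym (trans (×-assoc-* m 1# w) (×-congʳ m (*-identityˡ w)))

  binomial-difference : ∀ n x y z →
    (z + x) ^ n - (z + y) ^ n ≈ Σ n (λ k → nat K (n C k) * (z ^ k * (x ^ (n ∸ k) - y ^ (n ∸ k))))
  binomial-difference n x y z = begin
    (z + x) ^ n - (z + y) ^ n                   ≈⟨ +-cong (binomial n z x) (-‿cong (binomial n z y)) ⟩
    (Σ n P + P n) - (Σ n N + N n)               ≈⟨ +-congˡ (-‿cong (+-congˡ (sym top-terms-agree))) ⟩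
    (Σ n P + P n) - (Σ n N + P n)               ≈⟨ sub-+-cancelʳ _ _ _ ⟩
    Σ n P - Σ n N                               ≈⟨ Σ-distrib-sub n P N ⟨
    Σ n (λ k → P k - N k)                       ≈⟨ Σ-cong n (λ k _ → factor k) ⟩
    Σ n (λ k → nat K (n C k) * (z ^ k * (x ^ (n ∸ k) - y ^ (n ∸ k)))) ∎
    where
    P N : ℕ → Carrier
    P k = nat K (n C k) * (z ^ k * x ^ (n ∸ k))
    N k = nat K (n C k) * (z ^ k * y ^ (n ∸ k))
    top-terms-agree : P n ≈ N n
    top-terms-agree = *-congˡ (*-congˡ (trans (^-zero x (ℕₚ.n∸n≡0 n)) (sym (^-zero y (ℕₚ.n∸n≡0 n)))))
    factor : ∀ k → P k - N k ≈ nat K (n C k) * (z ^ k * (x ^ (n ∸ k) - y ^ (n ∸ k)))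
    factor k = sym (trans (*-congˡ (x[y-z]≈xy-xz _ _ _)) (x[y-z]≈xy-xz _ _ _))

  -- fpol K s x y z unfolds to geometric (z - y) (x - y) s.
  geometric : Carrier → Carrier → ℕ → Carrier
  geometric u v s = Σ s (λ j → u ^ j * v ^ (s ∸ 1 ∸ j))

  geometric-suc : ∀ u v s → geometric u v (suc s) ≈ v * geometric u v s + u ^ s
  geometric-suc u v s = +-cong lower-terms (trans (*-congˡ (^-zero v (ℕₚ.n∸n≡0 s))) (*-identityʳ _))
    where
    term : ∀ j → j < s → u ^ j * v ^ (s ∸ j) ≈ v * (u ^ j * v ^ (s ∸ 1 ∸ j))
    term j (s≤s {n = s′} j≤s′) = begin
      u ^ j * v ^ (suc s′ ∸ j)    ≈⟨ *-congˡ (^-congʳ v (ℕₚ.+-∸-assoc 1 j≤s′)) ⟩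
      u ^ j * (v * v ^ (s′ ∸ j))  ≈⟨ solve 3 (λ a v b → a :* (v :* b) := v :* (a :* b)) refl _ v _ ⟩
      v * (u ^ j * v ^ (s′ ∸ j))  ∎
    lower-terms : Σ s (λ j → u ^ j * v ^ (s ∸ j)) ≈ v * geometric u v s
    lower-terms = trans (Σ-cong s term) (sym (*-distribˡ-Σ s _ v))

  geometric-*-difference : ∀ u v s → geometric u v s * (u - v) ≈ u ^ s - v ^ s
  geometric-*-difference u v zero    = trans (zeroˡ _) (sym (-‿inverseʳ 1#))
  geometric-*-difference u v (suc s) = begin
    geometric u v (suc s) * (u - v)                    ≈⟨ *-congʳ (geometric-suc u v s) ⟩
    (v * geometric u v s + u ^ s) * (u - v)            ≈⟨ distribʳ _ _ _ ⟩
    v * geometric u v s * (u - v) + u ^ s * (u - v)    ≈⟨ +-congʳ (*-assoc _ _ _) ⟩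
    v * (geometric u v s * (u - v)) + u ^ s * (u - v)  ≈⟨ +-congʳ (*-congˡ (geometric-*-difference u v s)) ⟩
    v * (u ^ s - v ^ s) + u ^ s * (u - v)              ≈⟨ +-cong (x[y-z]≈xy-xz v _ _) (x[y-z]≈xy-xz (u ^ s) u v) ⟩
    (v * u ^ s - v * v ^ s) + (u ^ s * u - u ^ s * v)  ≈⟨ +-congˡ (+-cong (*-comm _ _) (-‿cong (*-comm _ _))) ⟩
    (v * u ^ s - v * v ^ s) + (u * u ^ s - v * u ^ s)  ≈⟨ sub-telescope _ _ _ ⟩
    u * u ^ s - v * v ^ s                              ∎

  fpol-*-difference : ∀ s x y z → fpol K s x y z * (z - x) ≈ (z - y) ^ s - (x - y) ^ s
  fpol-*-difference s x y z = trans (*-congˡ z-x≈[z-y]-[x-y]) (geometric-*-difference (z - y) (x - y) s)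
    where
    z-x≈[z-y]-[x-y] : z - x ≈ (z - y) - (x - y)
    z-x≈[z-y]-[x-y] = sym (trans (+-congˡ (⁻¹-anti-homo‿- x y)) (trans (+-comm _ _) (sub-telescope z y x)))

  x⁻¹*[x*y]≈y : ∀ {x} y → ¬ x ≈ 0# → x ⁻¹ * (x * y) ≈ y
  x⁻¹*[x*y]≈y {x} y x≉0 = begin
    x ⁻¹ * (x * y)  ≈⟨ solve 3 (λ x⁻¹ x y → x⁻¹ :* (x :* y) := (x :* x⁻¹) :* y) refl (x ⁻¹) x y ⟩
    (x * x ⁻¹) * y  ≈⟨ *-congʳ (inverseʳ x x≉0) ⟩
    1# * y          ≈⟨ *-identityˡ y ⟩
    y               ∎

  *-cancelˡ : ∀ {x y z} → ¬ x ≈ 0# → x * y ≈ x * z → y ≈ z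
  *-cancelˡ {x} {y} {z} x≉0 xy≈xz = begin
    y               ≈⟨ x⁻¹*[x*y]≈y y x≉0 ⟨
    x ⁻¹ * (x * y)  ≈⟨ *-congˡ xy≈xz ⟩
    x ⁻¹ * (x * z)  ≈⟨ x⁻¹*[x*y]≈y z x≉0 ⟩
    z               ∎

  *-cancelʳ : ∀ {x y z} → ¬ z ≈ 0# → x * z ≈ y * z → x ≈ y
  *-cancelʳ z≉0 xz≈yz = *-cancelˡ z≉0 (trans (*-comm _ _) (trans xz≈yz (*-comm _ _)))

  *-nonzero : ∀ {x y} → ¬ x ≈ 0# → ¬ y ≈ 0# → ¬ x * y ≈ 0#
  *-nonzero x≉0 y≉0 xy≈0 = y≉0 (*-cancelˡ x≉0 (trans xy≈0 (sym (zeroʳ _))))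

  ⁻¹-distrib-* : ∀ {x y} → ¬ x ≈ 0# → ¬ y ≈ 0# → (x * y) ⁻¹ ≈ x ⁻¹ * y ⁻¹
  ⁻¹-distrib-* {x} {y} x≉0 y≉0 = *-cancelˡ (*-nonzero x≉0 y≉0) (begin
    (x * y) * (x * y) ⁻¹       ≈⟨ inverseʳ _ (*-nonzero x≉0 y≉0) ⟩
    1#                         ≈⟨ *-identityˡ 1# ⟨
    1# * 1#                    ≈⟨ *-cong (inverseʳ x x≉0) (inverseʳ y y≉0) ⟨
    (x * x ⁻¹) * (y * y ⁻¹)
      ≈⟨ solve 4 (λ x y x⁻¹ y⁻¹ → (x :* x⁻¹) :* (y :* y⁻¹) := (x :* y) :* (x⁻¹ :* y⁻¹)) refl x y (x ⁻¹) (y ⁻¹) ⟩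
    (x * y) * (x ⁻¹ * y ⁻¹)    ∎)

  x^[n+1]*x⁻¹^n≈x : ∀ {x} → ¬ x ≈ 0# → ∀ n → x ^ suc n * (x ⁻¹) ^ n ≈ x
  x^[n+1]*x⁻¹^n≈x {x} x≉0 n = begin
    (x * x ^ n) * (x ⁻¹) ^ n  ≈⟨ *-assoc _ _ _ ⟩
    x * (x ^ n * (x ⁻¹) ^ n)  ≈⟨ *-congˡ (^-distrib-* x (x ⁻¹) n) ⟨
    x * (x * x ⁻¹) ^ n        ≈⟨ *-congˡ (trans (^-congˡ n (inverseʳ x x≉0)) (1^n≈1 n)) ⟩
    x * 1#                    ≈⟨ *-identityʳ x ⟩
    x                         ∎

  binomial-collapse : ∀ n → (∀ k → 0 < k → k < suc n → nat K (suc n C k) ≈ 0#) →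
                      ∀ u w → (u + w) ^ suc n ≈ u ^ suc n + w ^ suc n
  binomial-collapse n′ middle≈0 u w = begin
    (u + w) ^ n                                 ≈⟨ binomial n u w ⟩
    Σ n g + g n                                 ≈⟨ +-congʳ (Σ-suc n′ g) ⟩
    (g 0 + Σ n′ (λ k → g (suc k))) + g n        ≈⟨ +-congʳ (+-congˡ (Σ-≈0 n′ _ middle-terms≈0)) ⟩
    (g 0 + 0#) + g n                            ≈⟨ +-cong (trans (+-identityʳ _) first-term) last-term ⟩
    w ^ n + u ^ n                               ≈⟨ +-comm _ _ ⟩
    u ^ n + w ^ n                               ∎
    where
    n : ℕ
    n = suc n′
    g : ℕ → Carrier
    g k = nat K (n C k) * (u ^ k * w ^ (n ∸ k))
    middle-terms≈0 : ∀ k → k < n′ → g (suc k) ≈ 0#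
    middle-terms≈0 k k<n′ = trans (*-congʳ (middle≈0 (suc k) (s≤s z≤n) (s≤s k<n′))) (zeroˡ _)
    first-term : g 0 ≈ w ^ n
    first-term = trans (*-cong (+-identityʳ 1#) (*-identityˡ _)) (*-identityˡ _)
    last-term : g n ≈ u ^ n
    last-term = begin
      nat K (n C n) * (u ^ n * w ^ (n ∸ n))
        ≈⟨ *-cong (reflexive (≡.cong (nat K) (nCn≡1 n))) (*-congˡ (^-zero w (ℕₚ.n∸n≡0 n))) ⟩
      (1# + 0#) * (u ^ n * 1#)               ≈⟨ *-cong (+-identityʳ 1#) (*-identityʳ _) ⟩
      1# * u ^ n                             ≈⟨ *-identityˡ _ ⟩
      u ^ n                                  ∎

  nat-multiple≈0 : ∀ {p} → nat K p ≈ 0# → ∀ m → nat K (m ℕ.* p) ≈ 0#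
  nat-multiple≈0 {p} p≈0 m = trans (SemiringMult.×1-homo-* semiring m p) (trans (*-congˡ p≈0) (zeroʳ _))

  frobenius-sub : ∀ {p} → Prime p → nat K p ≈ 0# → ∀ u v → (u - v) ^ p ≈ u ^ p - v ^ p
  frobenius-sub {zero} p-prime with prime⇒2≤ p-prime
  ... | ()
  frobenius-sub {suc n} p-prime char-p u v = trans (frobenius-+ u (- v)) (+-congˡ -v^p≈-[v^p])
    where
    choose≈0 : ∀ k → 0 < k → k < suc n → nat K (suc n C k) ≈ 0#
    choose≈0 k 0<k k<p with prime∣choose p-prime 0<k k<p
    ... | divides m choose≡m*p = trans (reflexive (≡.cong (nat K) choose≡m*p)) (nat-multiple≈0 char-p m)
    frobenius-+ : ∀ u w → (u + w) ^ suc n ≈ u ^ suc n + w ^ suc n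
    frobenius-+ = binomial-collapse n choose≈0
    -v^p≈-[v^p] : (- v) ^ suc n ≈ - (v ^ suc n)
    -v^p≈-[v^p] = inverseˡ-unique _ _
      (trans (sym (frobenius-+ (- v) v)) (trans (^-congˡ (suc n) (-‿inverseˡ v)) (zeroˡ _)))

  frobenius-sub-^ : ∀ {p} → Prime p → nat K p ≈ 0# →
                    ∀ e u v → (u - v) ^ (p ℕ.^ e) ≈ u ^ (p ℕ.^ e) - v ^ (p ℕ.^ e)
  frobenius-sub-^ p-prime char-p zero u v =
    trans (*-identityʳ _) (sym (+-cong (*-identityʳ u) (-‿cong (*-identityʳ v))))
  frobenius-sub-^ {p} p-prime char-p (suc e) u v = begin
    (u - v) ^ (p ℕ.* p ℕ.^ e)                 ≈⟨ ^-p* (u - v) ⟩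
    ((u - v) ^ (p ℕ.^ e)) ^ p                 ≈⟨ ^-congˡ p (frobenius-sub-^ p-prime char-p e u v) ⟩
    (u ^ (p ℕ.^ e) - v ^ (p ℕ.^ e)) ^ p       ≈⟨ frobenius-sub p-prime char-p _ _ ⟩
    (u ^ (p ℕ.^ e)) ^ p - (v ^ (p ℕ.^ e)) ^ p ≈⟨ +-cong (^-p* u) (-‿cong (^-p* v)) ⟨
    u ^ (p ℕ.* p ℕ.^ e) - v ^ (p ℕ.* p ℕ.^ e) ∎
    where
    ^-p* : ∀ x → x ^ (p ℕ.* p ℕ.^ e) ≈ (x ^ (p ℕ.^ e)) ^ p
    ^-p* x = sym (trans (^-assocʳ x (p ℕ.^ e) p) (^-congʳ x (ℕₚ.*-comm (p ℕ.^ e) p)))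

  evalPoly-monomial : ∀ m a x → evalPoly K (replicate m 0 ++ [ a ]) x ≈ x ^ m * nat K a
  evalPoly-monomial zero    a x = trans (+-congˡ (zeroʳ x)) (trans (+-identityʳ _) (sym (*-identityˡ _)))
  evalPoly-monomial (suc m) a x =
    trans (+-identityˡ _) (trans (*-congˡ (evalPoly-monomial m a x)) (sym (*-assoc _ _ _)))

  -- θ^N = θ would make θ a root of X - X^N = X + (p - 1) X^N, whose coefficient 1 is prime to p.
  transcendental⇒θ^N≉θ : ∀ {p θ} → Prime p → nat K p ≈ 0# → TranscendentalOverPrimeField K p θ →
                          ∀ N → 2 ≤ N → ¬ θ ^ N ≈ θ
  transcendental⇒θ^N≉θ {zero} p-prime with prime⇒2≤ p-prime
  ... | ()
  transcendental⇒θ^N≉θ {suc p′} p-prime char-p transcendental 1 (s≤s ())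
  transcendental⇒θ^N≉θ {suc p′} {θ} p-prime char-p transcendental (suc (suc m)) _ θ^N≈θ
    with transcendental (0 ∷ 1 ∷ (replicate m 0 ++ [ p′ ])) root
    where
    p′≈-1 : nat K p′ ≈ - 1#
    p′≈-1 = inverseʳ-unique 1# (nat K p′) char-p
    root : evalPoly K (0 ∷ 1 ∷ (replicate m 0 ++ [ p′ ])) θ ≈ 0#
    root = begin
      0# + θ * ((1# + 0#) + θ * evalPoly K (replicate m 0 ++ [ p′ ]) θ)
        ≈⟨ trans (+-identityˡ _) (*-congˡ (+-cong (+-identityʳ 1#)
             (*-congˡ (trans (evalPoly-monomial m p′ θ) (*-congˡ p′≈-1))))) ⟩
      θ * (1# + θ * (θ ^ m * - 1#))
        ≈⟨ solve 4 (λ t o tm n → t :* (o :+ t :* (tm :* n)) := t :* o :+ (t :* (t :* tm)) :* n) refl θ 1# (θ ^ m) (- 1#) ⟩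
      θ * 1# + θ ^ suc (suc m) * - 1#
        ≈⟨ +-cong (*-identityʳ θ) (trans (sym (-‿distribʳ-* _ 1#)) (-‿cong (*-identityʳ _))) ⟩
      θ - θ ^ suc (suc m)
        ≈⟨ x≈y⇒x∙y⁻¹≈ε (sym θ^N≈θ) ⟩
      0# ∎
  ... | _ ∷ (p∣1 ∷ _) with ∣1⇒≡1 p∣1 | prime⇒2≤ p-prime
  ...   | ≡.refl | s≤s ()

module StuffleHomomorphism {c ℓ} (K : Field c ℓ) (q : ℕ) (θ : Field.Carrier K) where
  open Field K
  open Solver commutativeSemiring using (solve; _:=_; _:+_; _:*_)
  open SemiringExp semiring
  open SetoidReasoning setoid

  sumList : {A : Set} → (A → Carrier) → List A → Carrier
  sumList f = foldr (λ x acc → f x + acc) 0#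

  sumList-++ : {A : Set} (f : A → Carrier) (xs ys : List A) → sumList f (xs ++ ys) ≈ sumList f xs + sumList f ys
  sumList-++ f []       ys = sym (+-identityˡ _)
  sumList-++ f (x ∷ xs) ys = trans (+-congˡ (sumList-++ f xs ys)) (sym (+-assoc _ _ _))

  sumList-cong : {A : Set} {f g : A → Carrier} (xs : List A) → (∀ x → f x ≈ g x) → sumList f xs ≈ sumList g xs
  sumList-cong []       f≈g = refl
  sumList-cong (x ∷ xs) f≈g = +-cong (f≈g x) (sumList-cong xs f≈g)

  sumList-concatMap : {A B : Set} (f : B → Carrier) (g : A → List B) (xs : List A) →
                      sumList f (concatMap g xs) ≈ sumList (λ x → sumList f (g x)) xs
  sumList-concatMap f g []       = refl
  sumList-concatMap f g (x ∷ xs) = trans (sumList-++ f (g x) (concatMap g xs)) (+-congˡ (sumList-concatMap f g xs))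

  *-distribˡ-sumList : {A : Set} (f : A → Carrier) (x : Carrier) (xs : List A) →
                       x * sumList f xs ≈ sumList (λ y → x * f y) xs
  *-distribˡ-sumList f x []       = zeroʳ x
  *-distribˡ-sumList f x (y ∷ ys) = trans (distribˡ x _ _) (+-congˡ (*-distribˡ-sumList f x ys))

  *-distribʳ-sumList : {A : Set} (f : A → Carrier) (x : Carrier) (xs : List A) →
                       sumList f xs * x ≈ sumList (λ y → f y * x) xs
  *-distribʳ-sumList f x []       = zeroˡ x
  *-distribʳ-sumList f x (y ∷ ys) = trans (distribʳ x _ _) (+-congˡ (*-distribʳ-sumList f x ys))

  l⁻¹ : ℕ → Carrier
  l⁻¹ i = lfac K q θ i ⁻¹

  L< : ℕ → Array → Carrier
  L< = Llt K q θ

  L<⁺ : ℕ → HSum → Carrier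
  L<⁺ i = sumList (L< i)

  L<⁺-cons-zero : ∀ a xs → L<⁺ 0 (map (a ∷_) xs) ≈ 0#
  L<⁺-cons-zero a []       = refl
  L<⁺-cons-zero a (x ∷ xs) = trans (+-identityˡ _) (L<⁺-cons-zero a xs)

  L<⁺-cons-suc : ∀ i a xs → L<⁺ (suc i) (map (a ∷_) xs) ≈ L<⁺ i (map (a ∷_) xs) + l⁻¹ i ^ a * L<⁺ i xs
  L<⁺-cons-suc i a []       = sym (trans (+-identityˡ _) (zeroʳ _))
  L<⁺-cons-suc i a (x ∷ xs) = trans (+-congˡ (L<⁺-cons-suc i a xs))
    (solve 5 (λ u α l v w → (u :+ α :* l) :+ (v :+ α :* w) := (u :+ v) :+ α :* (l :+ w)) refl _ _ _ _ _)

  L<⁺-stuffle-cons : ∀ i a m b n →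
    L<⁺ i (stuffle (a ∷ m) (b ∷ n))
    ≈ L<⁺ i (map (a ∷_) (stuffle m (b ∷ n)))
      + (L<⁺ i (map (b ∷_) (stuffle (a ∷ m) n)) + L<⁺ i (map (a ℕ.+ b ∷_) (stuffle m n)))
  L<⁺-stuffle-cons i a m b n = trans (sumList-++ (L< i) X _) (+-congˡ (sumList-++ (L< i) Y Z))
    where
    X Y Z : HSum
    X = map (a ∷_) (stuffle m (b ∷ n))
    Y = map (b ∷_) (stuffle (a ∷ m) n)
    Z = map (a ℕ.+ b ∷_) (stuffle m n)

  L<⁺-stuffle-suc : ∀ i a m b n → let α = l⁻¹ i ^ a; β = l⁻¹ i ^ b in
    L<⁺ (suc i) (stuffle (a ∷ m) (b ∷ n))
    ≈ L<⁺ i (stuffle (a ∷ m) (b ∷ n))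
      + (α * L<⁺ i (stuffle m (b ∷ n)) + β * L<⁺ i (stuffle (a ∷ m) n) + α * β * L<⁺ i (stuffle m n))
  L<⁺-stuffle-suc i a m b n = begin
    L<⁺ (suc i) (stuffle (a ∷ m) (b ∷ n))
      ≈⟨ L<⁺-stuffle-cons (suc i) a m b n ⟩
    L<⁺ (suc i) X + (L<⁺ (suc i) Y + L<⁺ (suc i) Z)
      ≈⟨ +-cong (L<⁺-cons-suc i a mv) (+-cong (L<⁺-cons-suc i b un) (L<⁺-cons-suc i (a ℕ.+ b) mn)) ⟩
    (L<⁺ i X + α * L<⁺ i mv) + ((L<⁺ i Y + β * L<⁺ i un) + (L<⁺ i Z + l⁻¹ i ^ (a ℕ.+ b) * L<⁺ i mn))
      ≈⟨ +-congˡ (+-congˡ (+-congˡ (*-congʳ (^-homo-* (l⁻¹ i) a b)))) ⟩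
    (L<⁺ i X + α * L<⁺ i mv) + ((L<⁺ i Y + β * L<⁺ i un) + (L<⁺ i Z + α * β * L<⁺ i mn))
      ≈⟨ solve 8 (λ X Y Z α β mv un mn → (X :+ α :* mv) :+ ((Y :+ β :* un) :+ (Z :+ α :* β :* mn))
           := (X :+ (Y :+ Z)) :+ (α :* mv :+ β :* un :+ α :* β :* mn)) refl _ _ _ _ _ _ _ _ ⟩
    (L<⁺ i X + (L<⁺ i Y + L<⁺ i Z)) + (α * L<⁺ i mv + β * L<⁺ i un + α * β * L<⁺ i mn)
      ≈⟨ +-congʳ (L<⁺-stuffle-cons i a m b n) ⟨
    L<⁺ i (stuffle (a ∷ m) (b ∷ n)) + (α * L<⁺ i mv + β * L<⁺ i un + α * β * L<⁺ i mn)
      ∎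
    where
    mv un mn X Y Z : HSum
    mv = stuffle m (b ∷ n)
    un = stuffle (a ∷ m) n
    mn = stuffle m n
    X  = map (a ∷_) mv
    Y  = map (b ∷_) un
    Z  = map (a ℕ.+ b ∷_) mn
    α β : Carrier
    α = l⁻¹ i ^ a
    β = l⁻¹ i ^ b

  L<-stuffle : ∀ i u v → L<⁺ i (stuffle u v) ≈ L< i u * L< i v
  L<-stuffle i       []      v       = trans (+-identityʳ _) (sym (*-identityˡ _))
  L<-stuffle i       (a ∷ m) []      = trans (+-identityʳ _) (sym (*-identityʳ _))
  L<-stuffle zero    (a ∷ m) (b ∷ n) = begin
    L<⁺ 0 (stuffle (a ∷ m) (b ∷ n))
      ≈⟨ L<⁺-stuffle-cons 0 a m b n ⟩
    L<⁺ 0 (map (a ∷_) mv) + (L<⁺ 0 (map (b ∷_) un) + L<⁺ 0 (map (a ℕ.+ b ∷_) mn))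
      ≈⟨ +-cong (L<⁺-cons-zero a mv) (+-cong (L<⁺-cons-zero b un) (L<⁺-cons-zero (a ℕ.+ b) mn)) ⟩
    0# + (0# + 0#)
      ≈⟨ trans (+-identityˡ _) (trans (+-identityˡ _) (sym (zeroˡ 0#))) ⟩
    0# * 0#
      ∎
    where
    mv un mn : HSum
    mv = stuffle m (b ∷ n)
    un = stuffle (a ∷ m) n
    mn = stuffle m n
  -- The last expression is L< (suc i) u * L< (suc i) v by unfolding sumTo.
  L<-stuffle (suc i) u@(a ∷ m) v@(b ∷ n) = begin
    L<⁺ (suc i) (stuffle u v)
      ≈⟨ L<⁺-stuffle-suc i a m b n ⟩
    L<⁺ i (stuffle u v) + (α * L<⁺ i (stuffle m v) + β * L<⁺ i (stuffle u n) + α * β * L<⁺ i (stuffle m n))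
      ≈⟨ +-cong (L<-stuffle i u v) (+-cong (+-cong (*-congˡ (L<-stuffle i m v)) (*-congˡ (L<-stuffle i u n)))
                                          (*-congˡ (L<-stuffle i m n))) ⟩
    L< i u * L< i v + (α * (L< i m * L< i v) + β * (L< i u * L< i n) + α * β * (L< i m * L< i n))
      ≈⟨ solve 6 (λ u v α β m n → u :* v :+ (α :* (m :* v) :+ β :* (u :* n) :+ α :* β :* (m :* n))
           := (u :+ α :* m) :* (v :+ β :* n)) refl _ _ _ _ _ _ ⟩
    (L< i u + α * L< i m) * (L< i v + β * L< i n)
      ∎
    where
    α β : Carrier
    α = l⁻¹ i ^ a
    β = l⁻¹ i ^ b

  L<-⋆ : ∀ i xs ys → L<⁺ i (xs ⋆ ys) ≈ L<⁺ i xs * L<⁺ i ys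
  L<-⋆ i xs ys = begin
    L<⁺ i (xs ⋆ ys)
      ≈⟨ sumList-concatMap (L< i) _ xs ⟩
    sumList (λ x → L<⁺ i (concatMap (stuffle x) ys)) xs
      ≈⟨ sumList-cong xs (λ x → sumList-concatMap (L< i) (stuffle x) ys) ⟩
    sumList (λ x → sumList (λ y → L<⁺ i (stuffle x y)) ys) xs
      ≈⟨ sumList-cong xs (λ x → sumList-cong ys (L<-stuffle i x)) ⟩
    sumList (λ x → sumList (λ y → L< i x * L< i y) ys) xs
      ≈⟨ sumList-cong xs (λ x → *-distribˡ-sumList (L< i) (L< i x) ys) ⟨
    sumList (λ x → L< i x * L<⁺ i ys) xs
      ≈⟨ *-distribʳ-sumList (L< i) (L<⁺ i ys) xs ⟨
    L<⁺ i xs * L<⁺ i ys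
      ∎

  L<-stufflePow : ∀ i m k → L<⁺ i (stufflePow m k) ≈ L< i m ^ k
  L<-stufflePow i m zero    = +-identityʳ _
  L<-stufflePow i m (suc k) = trans (L<-⋆ i [ m ] (stufflePow m k)) (*-cong (+-identityʳ _) (L<-stufflePow i m k))

  LH-· : ∀ i n xs → LH K q θ i ([ n ] · xs) ≈ l⁻¹ i ^ n * L<⁺ i xs
  LH-· i n []       = sym (zeroʳ _)
  LH-· i n (x ∷ xs) = trans (+-congˡ (LH-· i n xs)) (sym (distribˡ _ _ _))

  LH-cArr : ∀ i d k → LH K q θ i (cArr q d k) ≈ l⁻¹ i ^ ((d ∸ k) ℕ.* (q ∸ 1)) * L< i [ q ∸ 1 ] ^ k
  LH-cArr i d k =
    trans (LH-· i ((d ∸ k) ℕ.* (q ∸ 1)) (stufflePow [ q ∸ 1 ] k)) (*-congˡ (L<-stufflePow i [ q ∸ 1 ] k))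

module InCharacteristicP {c ℓ} (K : Field c ℓ) (p e : ℕ) (p-prime : Prime p) (e≥1 : 1 ≤ e) (θ : Field.Carrier K)
               (char-p : Field._≈_ K (nat K p) (Field.0# K)) (transcendental : TranscendentalOverPrimeField K p θ) where
  open Field K
  open Solver commutativeSemiring using (solve; _:=_; _:*_)
  open SemiringExp semiring
  open CommSemiringExp commutativeSemiring using (^-distrib-*)
  open RingProperties ring using ([y-z]x≈yx-zx)
  open AbelianGroupProperties +-abelianGroup using (x∙y⁻¹≈ε⇒x≈y; x≈y⇒x∙y⁻¹≈ε)
  open FieldProperties K
  open SetoidReasoning setoid

  q : ℕ
  q = p ℕ.^ e

  open StuffleHomomorphism K q θ public

  2≤q : 2 ≤ q
  2≤q = 2≤m^n (prime⇒2≤ p-prime) e≥1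

  θ^q θ-θ^q : Carrier
  θ^q   = θ ^ q
  θ-θ^q = θ - θ^q

  θ^q^ : ℕ → Carrier
  θ^q^ n = θ ^ (q ℕ.^ n)

  α β : ℕ → Carrier
  α i = l⁻¹ i ^ (q ∸ 1)
  β i = L< i [ q ∸ 1 ]

  θ^q^n≉θ : ∀ {n} → 1 ≤ n → ¬ θ^q^ n ≈ θ
  θ^q^n≉θ {n} 1≤n = transcendental⇒θ^N≉θ p-prime char-p transcendental (q ℕ.^ n) (2≤m^n 2≤q 1≤n)

  θ^q^j-θ≉0 : ∀ {j} → 1 ≤ j → ¬ θ^q^ j - θ ≈ 0#
  θ^q^j-θ≉0 1≤j ≈0 = θ^q^n≉θ 1≤j (x∙y⁻¹≈ε⇒x≈y _ _ ≈0)

  θ-θ^q^[1+i]≉0 : ∀ i → ¬ θ - θ^q^ (suc i) ≈ 0#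
  θ-θ^q^[1+i]≉0 i ≈0 = θ^q^n≉θ {suc i} (s≤s z≤n) (sym (x∙y⁻¹≈ε⇒x≈y _ _ ≈0))

  lfac≉0 : ∀ i → ¬ lfac K q θ i ≈ 0#
  lfac≉0 zero    = 1≉0
  lfac≉0 (suc i) = *-nonzero (lfac≉0 i) (θ-θ^q^[1+i]≉0 i)

  l⁻¹^[n*[q∸1]]≈α^n : ∀ i n → l⁻¹ i ^ (n ℕ.* (q ∸ 1)) ≈ α i ^ n
  l⁻¹^[n*[q∸1]]≈α^n i n =
    sym (trans (^-assocʳ (l⁻¹ i) (q ∸ 1) n) (^-congʳ (l⁻¹ i) (ℕₚ.*-comm (q ∸ 1) n)))

  LH-cArr≈α^[d∸k]*β^k : ∀ i d k → LH K q θ i (cArr q d k) ≈ α i ^ (d ∸ k) * β i ^ k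
  LH-cArr≈α^[d∸k]*β^k i d k = trans (LH-cArr i d k) (*-congʳ (l⁻¹^[n*[q∸1]]≈α^n i (d ∸ k)))

  frobeniusIdentity : ∀ i → (θ^q - θ^q^ (suc i)) * α i ≈ θ-θ^q * β i
  shifted-frobeniusIdentity : ∀ i x → (x - θ^q^ (suc i)) * α i ≈ θ-θ^q * β i + (x - θ^q) * α i

  frobeniusIdentity zero = begin
    (θ^q - θ^q^ 1) * α 0  ≈⟨ *-congʳ (x≈y⇒x∙y⁻¹≈ε (sym (^-congʳ θ (ℕₚ.*-identityʳ q)))) ⟩
    0# * α 0              ≈⟨ zeroˡ _ ⟩
    0#                    ≈⟨ zeroʳ _ ⟨
    θ-θ^q * β 0           ∎
  frobeniusIdentity (suc i) = begin
    (θ^q - θ^q^ (suc (suc i))) * α (suc i)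
      ≈⟨ *-cong (sym frobenius) (^-congˡ (q ∸ 1) (⁻¹-distrib-* (lfac≉0 i) w≉0)) ⟩
    w ^ suc (q ∸ 1) * (l⁻¹ i * w ⁻¹) ^ (q ∸ 1) ≈⟨ *-congˡ (^-distrib-* (l⁻¹ i) (w ⁻¹) (q ∸ 1)) ⟩
    w ^ suc (q ∸ 1) * (α i * (w ⁻¹) ^ (q ∸ 1))
      ≈⟨ solve 3 (λ w α w⁻¹ → w :* (α :* w⁻¹) := (w :* w⁻¹) :* α) refl _ (α i) _ ⟩
    (w ^ suc (q ∸ 1) * (w ⁻¹) ^ (q ∸ 1)) * α i ≈⟨ *-congʳ (x^[n+1]*x⁻¹^n≈x w≉0 (q ∸ 1)) ⟩
    w * α i                                    ≈⟨ shifted-frobeniusIdentity i θ ⟩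
    θ-θ^q * β i + θ-θ^q * α i                  ≈⟨ distribˡ θ-θ^q (β i) (α i) ⟨
    θ-θ^q * (β i + α i)                        ≈⟨ *-congˡ (+-congˡ (*-identityʳ (α i))) ⟨
    θ-θ^q * β (suc i)                          ∎
    where
    w : Carrier
    w = θ - θ^q^ (suc i)
    w≉0 : ¬ w ≈ 0#
    w≉0 = θ-θ^q^[1+i]≉0 i
    frobenius : w ^ suc (q ∸ 1) ≈ θ^q - θ^q^ (suc (suc i))
    frobenius = begin
      w ^ suc (q ∸ 1)                  ≈⟨ ^-congʳ w (ℕₚ.suc-pred q {{ℕ.>-nonZero (ℕₚ.<-trans (s≤s z≤n) 2≤q)}}) ⟩
      w ^ q                            ≈⟨ frobenius-sub-^ p-prime char-p e θ (θ^q^ (suc i)) ⟩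
      θ^q - θ^q^ (suc i) ^ q
        ≈⟨ +-congˡ (-‿cong (trans (^-assocʳ θ (q ℕ.^ suc i) q) (^-congʳ θ (ℕₚ.*-comm (q ℕ.^ suc i) q)))) ⟩
      θ^q - θ^q^ (suc (suc i))         ∎

  shifted-frobeniusIdentity i x = begin
    (x - θ^q^ (suc i)) * α i                      ≈⟨ *-congʳ (sub-telescope x θ^q (θ^q^ (suc i))) ⟨
    ((θ^q - θ^q^ (suc i)) + (x - θ^q)) * α i      ≈⟨ distribʳ _ _ _ ⟩
    (θ^q - θ^q^ (suc i)) * α i + (x - θ^q) * α i  ≈⟨ +-congʳ (frobeniusIdentity i) ⟩
    θ-θ^q * β i + (x - θ^q) * α i                 ∎

  lhs-*-difference : ∀ d i j →
    fpol K d θ (θ^q^ (suc i)) (θ^q^ j) * l⁻¹ i ^ (d ℕ.* (q ∸ 1)) * (θ^q^ j - θ)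
    ≈ (θ-θ^q * β i + (θ^q^ j - θ^q) * α i) ^ d - (θ-θ^q * β i + θ-θ^q * α i) ^ d
  lhs-*-difference d i j = begin
    f * l⁻¹ i ^ (d ℕ.* (q ∸ 1)) * (z - θ)      ≈⟨ *-congʳ (*-congˡ (l⁻¹^[n*[q∸1]]≈α^n i d)) ⟩
    f * α i ^ d * (z - θ)                      ≈⟨ solve 3 (λ f a w → f :* a :* w := (f :* w) :* a) refl _ _ _ ⟩
    f * (z - θ) * α i ^ d                      ≈⟨ *-congʳ (fpol-*-difference d θ y z) ⟩
    ((z - y) ^ d - (θ - y) ^ d) * α i ^ d      ≈⟨ [y-z]x≈yx-zx _ _ _ ⟩
    (z - y) ^ d * α i ^ d - (θ - y) ^ d * α i ^ d
      ≈⟨ +-cong (^-distrib-* (z - y) (α i) d) (-‿cong (^-distrib-* (θ - y) (α i) d)) ⟨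
    ((z - y) * α i) ^ d - ((θ - y) * α i) ^ d
      ≈⟨ +-cong (^-congˡ d (shifted-frobeniusIdentity i z)) (-‿cong (^-congˡ d (shifted-frobeniusIdentity i θ))) ⟩
    (θ-θ^q * β i + (z - θ^q) * α i) ^ d - (θ-θ^q * β i + θ-θ^q * α i) ^ d ∎
    where
    y z f : Carrier
    y = θ^q^ (suc i)
    z = θ^q^ j
    f = fpol K d θ y z

  rhs-term-*-difference : ∀ d i j k →
    nat K (d C k) * θ-θ^q ^ k * fpol K (d ∸ k) θ θ^q (θ^q^ j) * LH K q θ i (cArr q d k) * (θ^q^ j - θ)
    ≈ nat K (d C k) * ((θ-θ^q * β i) ^ k * (((θ^q^ j - θ^q) * α i) ^ (d ∸ k) - (θ-θ^q * α i) ^ (d ∸ k)))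
  rhs-term-*-difference d i j k = begin
    n * T ^ k * f * LH K q θ i (cArr q d k) * (z - θ)  ≈⟨ *-congʳ (*-congˡ (LH-cArr≈α^[d∸k]*β^k i d k)) ⟩
    n * T ^ k * f * (α i ^ m * β i ^ k) * (z - θ)
      ≈⟨ solve 6 (λ n t f a b w → n :* t :* f :* (a :* b) :* w := n :* ((t :* b) :* ((f :* w) :* a))) refl
           n (T ^ k) f (α i ^ m) (β i ^ k) (z - θ) ⟩
    n * ((T ^ k * β i ^ k) * ((f * (z - θ)) * α i ^ m))
      ≈⟨ *-congˡ (*-cong (sym (^-distrib-* T (β i) k)) (*-congʳ (fpol-*-difference m θ θ^q z))) ⟩
    n * ((T * β i) ^ k * ((U ^ m - T ^ m) * α i ^ m))
      ≈⟨ *-congˡ (*-congˡ ([y-z]x≈yx-zx _ _ _)) ⟩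
    n * ((T * β i) ^ k * (U ^ m * α i ^ m - T ^ m * α i ^ m))
      ≈⟨ *-congˡ (*-congˡ (+-cong (^-distrib-* U (α i) m) (-‿cong (^-distrib-* T (α i) m)))) ⟨
    n * ((T * β i) ^ k * ((U * α i) ^ m - (T * α i) ^ m)) ∎
    where
    m : ℕ
    m = d ∸ k
    n T z U f : Carrier
    n = nat K (d C k)
    T = θ-θ^q
    z = θ^q^ j
    U = z - θ^q
    f = fpol K m θ θ^q z

mainTheorem9 :
  ∀ {c ℓ} (K : Field c ℓ) (p e : ℕ) → Prime p → 1 ≤ e →
  (θ : Field.Carrier K) →
  Field._≈_ K (nat K p) (Field.0# K) →
  TranscendentalOverPrimeField K p θ →
  (d : ℕ) → 1 ≤ d →
  (i j : ℕ) → 1 ≤ j →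
  let open Field K
      q = p ℕ.^ e
  in fpol K d θ (powF K θ (q ℕ.^ suc i)) (powF K θ (q ℕ.^ j))
       * powF K (lfac K q θ i ⁻¹) (d ℕ.* (q ∸ 1))
     ≈ sumTo K d (λ k →
         nat K (d C k)
         * powF K (θ - powF K θ q) k
         * fpol K (d ∸ k) θ (powF K θ q) (powF K θ (q ℕ.^ j))
         * LH K q θ i (cArr q d k))
mainTheorem9 K p e p-prime e≥1 θ char-p transcendental d _ i j j≥1 =
  *-cancelʳ (θ^q^j-θ≉0 j≥1) (begin
    lhs * (θ^q^ j - θ)
      ≈⟨ lhs-*-difference d i j ⟩
    (Tβ + U * α i) ^ d - (Tβ + T * α i) ^ d
      ≈⟨ binomial-difference d (U * α i) (T * α i) Tβ ⟩
    Σ d (λ k → nat K (d C k) * (Tβ ^ k * ((U * α i) ^ (d ∸ k) - (T * α i) ^ (d ∸ k))))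
      ≈⟨ Σ-cong d (λ k _ → rhs-term-*-difference d i j k) ⟨
    Σ d (λ k → term k * (θ^q^ j - θ))
      ≈⟨ *-distribʳ-Σ d term (θ^q^ j - θ) ⟨
    Σ d term * (θ^q^ j - θ)
      ∎)
  where
  open Field K
  open FieldProperties K
  open InCharacteristicP K p e p-prime e≥1 θ char-p transcendental
  open SemiringExp semiring using (_^_)
  open SetoidReasoning setoid
  T U Tβ lhs : Carrier
  T   = θ-θ^q
  U   = θ^q^ j - θ^q
  Tβ  = T * β i
  lhs = fpol K d θ (θ^q^ (suc i)) (θ^q^ j) * l⁻¹ i ^ (d ℕ.* (q ∸ 1))
  term : ℕ → Carrier
  term k = nat K (d C k) * T ^ k * fpol K (d ∸ k) θ θ^q (θ^q^ j) * LH K q θ i (cArr q d k)
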